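{- Let $n\ge 3$, $p\ge 1$ and $k\ge 1$ be integers, and put $r=\min\{k-1,p\}$. Then $$C_k(C_n\odot K_p)=r\cdot n+C_{k-r}(C_n\odot K_{p-r}),$$ where $C_n\odot K_0$ is understood to be the cycle $C_n$. Explicitly, $$C_k(C_n\odot K_p)=\begin{cases}(k-1)n+C_1(C_n\odot K_{p-(k-1)}) & \text{if } k<p+1,\\ pn+C_{k-p}(C_n) & \text{if } k\ge p+1.\end{cases}$$
   Context: Irreversible $k$-threshold process on a finite simple graph $G=(V,E)$: start with a set $S_0\subseteq V$ of colored vertices; for $t\ge1$, $S_t$ consists of $S_{t-1}$ together with every vertex having at least $k$ neighbors in $S_{t-1}$ (colored vertices stay colored). $S_0$ is an irreversible $k$-threshold conversion set if $S_t=V$ for some $t\ge 0$. The irreversible $k$-threshold conversion number $C_k(G)$ is the minimum size of such a set. $G$ is called $k$-inconvertible if $C_k(G)=|V|$. Corona product $C_n\odot K_p$: take a cycle $C_n$ with vertices $v_1,\dots,v_n$ and $n$ disjoint copies of the complete graph $K_p$, the $i$-th copy having vertices $u_i^1,\dots,u_i^p$; join $v_i$ by an edge to every $u_i^j$, $1\le j\le p$. It has $n(p+1)$ vertices. $K_0$ denotes the graph with no vertices, so $C_n\odot K_0=C_n$. -}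

module Defs where

open import Data.Nat using (ℕ; zero; suc; _+_; _*_; _≤_; _≥_; _≡ᵇ_; _≤ᵇ_)
open import Data.Fin using (Fin; toℕ; remQuot)
open import Data.Fin.Properties using (_≟_)
open import Data.Bool using (Bool; true; false; _∧_; _∨_; not; if_then_else_)
open import Data.List using (List; map; sum; filterᵇ; length)
open import Data.List.Base using (allFin)
open import Data.Product using (Σ; _×_; _,_; ∃)
open import Relation.Nullary.Decidable using (⌊_⌋)
open import Relation.Binary.PropositionalEquality using (_≡_)

record Graph : Set where
  field
    N   : ℕ
    adj : Fin N → Fin N → Bool
open Graph public

VSet : Graph → Set
VSet G = Fin (N G) → Bool

size : (G : Graph) → VSet G → ℕ
size G S = length (filterᵇ S (allFin (N G)))

nbrsIn : (G : Graph) → VSet G → Fin (N G) → ℕ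
nbrsIn G S v = length (filterᵇ (λ u → adj G v u ∧ S u) (allFin (N G)))

step : (G : Graph) → ℕ → VSet G → VSet G
step G k S v = S v ∨ (k ≤ᵇ nbrsIn G S v)

iter : (G : Graph) → ℕ → ℕ → VSet G → VSet G
iter G k zero    S = S
iter G k (suc t) S = step G k (iter G k t S)

IsConversionSet : (G : Graph) → ℕ → VSet G → Set
IsConversionSet G k S = ∃ λ t → ∀ v → iter G k t S v ≡ true

IsConvNumber : (G : Graph) → ℕ → ℕ → Set
IsConvNumber G k m =
  (Σ (VSet G) λ S → IsConversionSet G k S × size G S ≡ m)
  × (∀ S → IsConversionSet G k S → m ≤ size G S)

cycNext : (n : ℕ) → Fin n → Fin n → Bool
cycNext n i j = (suc (toℕ i) ≡ᵇ toℕ j) ∨ ((suc (toℕ i) ≡ᵇ n) ∧ (toℕ j ≡ᵇ 0))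

cycAdj : (n : ℕ) → Fin n → Fin n → Bool
cycAdj n i j = cycNext n i j ∨ cycNext n j i

-- Adjacency in C_n ⊙ K_p on pairs (i , a), with a = zero meaning v_i
-- and a = suc j meaning u_i^(j+1).
coronaAdj : (n p : ℕ) → Fin n × Fin (suc p) → Fin n × Fin (suc p) → Bool
coronaAdj n p (i , Fin.zero)  (j , Fin.zero)  = cycAdj n i j
coronaAdj n p (i , Fin.zero)  (j , Fin.suc _) = ⌊ i ≟ j ⌋
coronaAdj n p (i , Fin.suc _) (j , Fin.zero)  = ⌊ i ≟ j ⌋
coronaAdj n p (i , Fin.suc x) (j , Fin.suc y) = ⌊ i ≟ j ⌋ ∧ not ⌊ x ≟ y ⌋

-- The corona product C_n ⊙ K_p, with n (p+1) vertices, encoded via remQuot.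
-- For p = 0 this is the cycle C_n.
corona : (n p : ℕ) → Graph
corona n p = record
  { N   = n * suc p
  ; adj = λ x y → coronaAdj n p (remQuot (suc p) x) (remQuot (suc p) y)
  }

-- A clique vertex u_i^j of C_n ⊙ K_p is adjacent only to v_i and to the other p − 1
-- vertices of its clique.
--
-- If k > p, an uncoloured clique vertex never has k coloured neighbours, so every
-- conversion set contains all pn clique vertices. Each v_i then sees p coloured clique
-- neighbours, and on the cycle vertices the process is the (k − p)-process on C_n;
-- hence C_k = pn + C_{k−p}(C_n).
--
-- If k = k₀ + 1 ≤ p + 1, a clique holding fewer than k₀ vertices of S_0 is frozen (each
-- of its uncoloured vertices sees at most 1 + (k₀ − 1) coloured neighbours), so every
-- clique holds at least k₀ of them; and if every block {v_i} ∪ K_p^{(i)} held exactly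
-- k₀, no cycle vertex would be coloured and nothing would ever change. So
-- C_k ≥ k₀n + 1, which is attained by v_1 together with k₀ vertices of every clique:
-- the colour runs around the cycle and then fills the cliques. For k₀ = 0 this gives
-- C_1 = 1, the remaining term of the formula when k ≤ p.

module Submission where

open import Defs
open import Data.Nat
  using (ℕ; zero; suc; _+_; _*_; _∸_; _⊓_; _≤_; _<_; _≥_; _≤ᵇ_; _<ᵇ_; _≡ᵇ_; z≤n; s≤s; _≤?_)
open import Data.Nat.Properties hiding (_≟_)
import Data.Nat.Properties as ℕₚ
open import Data.Fin as Fin using (Fin; zero; suc; combine; remQuot; _↑ˡ_; _↑ʳ_)
open import Data.Fin.Properties as Finₚ using (_≟_; all?)
open import Data.Bool using (Bool; true; false; _∧_; _∨_; not)
open import Data.List using (filterᵇ; length; tabulate)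
open import Data.Vec using (lookup) renaming (tabulate to tabulateᵥ)
open import Data.Vec.Properties using (lookup∘tabulate)
open import Data.Fin.Subset.Properties using (anySubset?)
import Data.Bool.Properties as Boolₚ
open import Data.Product using (Σ; ∃; _×_; _,_; proj₁; uncurry)
open import Data.Sum using (_⊎_; inj₁; inj₂)
open import Data.Empty using (⊥-elim)
open import Function using (_∘_; id; case_of_; _⇔_; mk⇔)
open import Relation.Nullary using (¬_; Dec; yes; no; map′; _×-dec_)
open import Relation.Nullary.Decidable using (⌊_⌋; dec-true; dec-false; isYes≗does; does-⇔)
open import Relation.Binary.PropositionalEquality
open import Algebra.Properties.CommutativeMonoid.Sum +-0-commutativeMonoid
  using (sum; sum-syntax; sum-cong-≗; ∑-distrib-+; sum-replicate-zero)

indicator : Bool → ℕ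
indicator true  = 1
indicator false = 0

count : ∀ {n} → (Fin n → Bool) → ℕ
count f = sum (indicator ∘ f)

_⊆_ : ∀ {n} → (Fin n → Bool) → (Fin n → Bool) → Set
f ⊆ g = ∀ x → f x ≡ true → g x ≡ true

sum-mono-≤ : ∀ {n} {f g : Fin n → ℕ} → (∀ x → f x ≤ g x) → sum f ≤ sum g
sum-mono-≤ {zero}  f≤g = z≤n
sum-mono-≤ {suc n} f≤g = +-mono-≤ (f≤g zero) (sum-mono-≤ (f≤g ∘ suc))

sum-const : ∀ n c → sum {n} (λ _ → c) ≡ n * c
sum-const zero    c = refl
sum-const (suc n) c = cong (c +_) (sum-const n c)

*-≤-sum : ∀ {n} {f : Fin n → ℕ} c → (∀ x → c ≤ f x) → n * c ≤ sum f
*-≤-sum {n} {f} c c≤f = subst (_≤ sum f) (sum-const n c) (sum-mono-≤ c≤f)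

*-<-sum : ∀ {n} {f : Fin n → ℕ} c → (∀ x → c ≤ f x) → ∀ i → c < f i → n * c < sum f
*-<-sum c c≤f zero    c<f₀ = +-mono-<-≤ c<f₀ (*-≤-sum c (c≤f ∘ suc))
*-<-sum c c≤f (suc i) c<fᵢ = +-mono-≤-< (c≤f zero) (*-<-sum c (c≤f ∘ suc) i c<fᵢ)

term≤sum : ∀ {n} {f : Fin n → ℕ} i → f i ≤ sum f
term≤sum {suc n} {f} zero    = m≤m+n (f zero) _
term≤sum {suc n} {f} (suc i) = ≤-trans (term≤sum {f = f ∘ suc} i) (m≤n+m _ (f zero))

sum-single : ∀ {n} {f : Fin n → ℕ} i → (∀ j → j ≢ i → f j ≡ 0) → sum f ≡ f i
sum-single {suc n} {f} zero    f≡0 = begin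
  f zero + sum (f ∘ suc)       ≡⟨ cong (f zero +_) (sum-cong-≗ (λ j → f≡0 (suc j) λ ())) ⟩
  f zero + sum {n} (λ _ → 0)   ≡⟨ cong (f zero +_) (sum-replicate-zero n) ⟩
  f zero + 0                   ≡⟨ +-identityʳ _ ⟩
  f zero                       ∎
  where open ≡-Reasoning
sum-single {suc n} {f} (suc i) f≡0 =
  cong₂ _+_ (f≡0 zero λ ()) (sum-single i λ j j≢i → f≡0 (suc j) (j≢i ∘ Finₚ.suc-injective))

sum-↑ : ∀ m n (f : Fin (m + n) → ℕ) → sum f ≡ sum (λ i → f (i ↑ˡ n)) + sum (λ j → f (m ↑ʳ j))
sum-↑ zero    n f = refl
sum-↑ (suc m) n f = trans (cong (f zero +_) (sum-↑ m n (f ∘ suc))) (sym (+-assoc (f zero) _ _))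

sum-combine : ∀ m n (f : Fin (m * n) → ℕ) → sum f ≡ sum {m} (λ i → sum {n} (λ j → f (combine i j)))
sum-combine zero    n f = refl
sum-combine (suc m) n f =
  trans (sum-↑ n (m * n) f) (cong (sum (λ j → f (j ↑ˡ (m * n))) +_) (sum-combine m n (λ x → f (n ↑ʳ x))))

indicator≤1 : ∀ b → indicator b ≤ 1
indicator≤1 true  = ≤-refl
indicator≤1 false = z≤n

count-cong : ∀ {n} {f g : Fin n → Bool} → f ≗ g → count f ≡ count g
count-cong f≗g = sum-cong-≗ (cong indicator ∘ f≗g)

count-mono : ∀ {n} {f g : Fin n → Bool} → f ⊆ g → count f ≤ count g
count-mono {f = f} f⊆g = sum-mono-≤ λ x → indicator-mono (f x) (f⊆g x)
  where
  indicator-mono : ∀ a {b} → (a ≡ true → b ≡ true) → indicator a ≤ indicator b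
  indicator-mono true  a⇒b rewrite a⇒b refl = ≤-refl
  indicator-mono false a⇒b = z≤n

count-false : ∀ {n} {f : Fin n → Bool} → (∀ x → f x ≡ false) → count f ≡ 0
count-false {n} f≡false = trans (count-cong f≡false) (sum-replicate-zero n)

count-true : ∀ {n} {f : Fin n → Bool} → (∀ x → f x ≡ true) → count f ≡ n
count-true {n} f≡true = trans (count-cong f≡true) (trans (sum-const n 1) (*-identityʳ n))

count≤n : ∀ {n} (f : Fin n → Bool) → count f ≤ n
count≤n {zero}  f = z≤n
count≤n {suc n} f = +-mono-≤ (indicator≤1 (f zero)) (count≤n (f ∘ suc))

count<n : ∀ {n} (f : Fin n → Bool) x → f x ≡ false → count f < n
count<n {suc n} f zero    f₀≡false rewrite f₀≡false = s≤s (count≤n (f ∘ suc))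
count<n {suc n} f (suc x) fₓ≡false =
  subst (_≤ suc n) (+-suc (indicator (f zero)) _) (+-mono-≤ (indicator≤1 (f zero)) (count<n (f ∘ suc) x fₓ≡false))

count<n⇒∃false : ∀ {n} (f : Fin n → Bool) → count f < n → ∃ λ x → f x ≡ false
count<n⇒∃false {suc n} f count<n with f zero in f₀≡
... | false = zero , f₀≡
... | true  = let x , fₓ≡false = count<n⇒∃false (f ∘ suc) (≤-pred count<n) in suc x , fₓ≡false

n≤count⇒true : ∀ {n} (f : Fin n → Bool) → n ≤ count f → ∀ x → f x ≡ true
n≤count⇒true f n≤count x with f x in fₓ≡
... | true  = refl
... | false = ⊥-elim (<⇒≱ (count<n f x fₓ≡) n≤count)

count-⊆ : ∀ {n} (f g : Fin n → Bool) → f ⊆ g → f ≗ g ⊎ count f < count g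
count-⊆ {zero}  f g f⊆g = inj₁ λ ()
count-⊆ {suc n} f g f⊆g with f zero in f₀≡ | g zero in g₀≡ | count-⊆ (f ∘ suc) (g ∘ suc) (f⊆g ∘ suc)
... | true  | false | _ = case (trans (sym (f⊆g zero f₀≡)) g₀≡) of λ ()
... | false | true  | _ = inj₂ (s≤s (count-mono (f⊆g ∘ suc)))
... | true  | true  | inj₂ lt = inj₂ (s≤s lt)
... | false | false | inj₂ lt = inj₂ lt
... | true  | true  | inj₁ eq = inj₁ λ { zero → trans f₀≡ (sym g₀≡) ; (suc x) → eq x }
... | false | false | inj₁ eq = inj₁ λ { zero → trans f₀≡ (sym g₀≡) ; (suc x) → eq x }

count-≢ : ∀ {n} (f : Fin n → Bool) x → f x ≡ false → count (λ y → not ⌊ x ≟ y ⌋ ∧ f y) ≡ count f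
count-≢ f x fₓ≡false = count-cong λ y → lemma y (x ≟ y)
  where
  lemma : ∀ y (x≟y : Dec (x ≡ y)) → not ⌊ x≟y ⌋ ∧ f y ≡ f y
  lemma y (yes refl) = sym fₓ≡false
  lemma y (no _)     = refl

below : ∀ {n} → ℕ → Fin n → Bool
below j x = Fin.toℕ x <ᵇ j

count-below : ∀ {n} j → j ≤ n → count (below {n} j) ≡ j
count-below {n}     zero    _         = count-false {n} λ _ → refl
count-below {suc n} (suc j) (s≤s j≤n) = cong suc (count-below j j≤n)

length-filterᵇ-tabulate : ∀ {n} {A : Set} (P : A → Bool) (g : Fin n → A) →
                          length (filterᵇ P (tabulate g)) ≡ count (P ∘ g)
length-filterᵇ-tabulate {zero}  P g = refl
length-filterᵇ-tabulate {suc n} P g with P (g zero)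
... | true  = cong suc (length-filterᵇ-tabulate P (g ∘ suc))
... | false = length-filterᵇ-tabulate P (g ∘ suc)

size≡count : (G : Graph) (S : VSet G) → size G S ≡ count S
size≡count G S = length-filterᵇ-tabulate S id

size-cong : (G : Graph) {S S′ : VSet G} → S ≗ S′ → size G S ≡ size G S′
size-cong G {S} {S′} S≗S′ = trans (size≡count G S) (trans (count-cong S≗S′) (sym (size≡count G S′)))

nbrsIn≡count : (G : Graph) (S : VSet G) (w : Fin (N G)) → nbrsIn G S w ≡ count (λ w′ → adj G w w′ ∧ S w′)
nbrsIn≡count G S w = length-filterᵇ-tabulate (λ w′ → adj G w w′ ∧ S w′) id

least : {Q : ℕ → Set} → (∀ m → Dec (Q m)) → ∀ {m} → Q m → Σ ℕ λ l → Q l × (∀ j → Q j → l ≤ j)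
least {Q} Q? {m} qm = search m 0 (λ _ ()) (subst Q (sym (+-identityʳ m)) qm)
  where
  search : ∀ fuel l → (∀ j → j < l → ¬ Q j) → Q (fuel + l) → Σ ℕ λ l → Q l × (∀ j → Q j → l ≤ j)
  search fuel l none<l q with Q? l
  ... | yes ql = l , ql , λ j qj → ≮⇒≥ λ j<l → none<l j j<l qj
  search zero       l none<l q | no ¬ql = ⊥-elim (¬ql q)
  search (suc fuel) l none<l q | no ¬ql = search fuel (suc l) none≤l (subst Q (sym (+-suc fuel l)) q)
    where
    none≤l : ∀ j → j < suc l → ¬ Q j
    none≤l j j<1+l with m<1+n⇒m<n∨m≡n j<1+l
    ... | inj₁ j<l  = none<l j j<l
    ... | inj₂ refl = ¬ql

module _ (G : Graph) (k : ℕ) where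

  step-cong : ∀ {S S′} → S ≗ S′ → step G k S ≗ step G k S′
  step-cong S≗S′ w = cong₂ (λ b m → b ∨ (k ≤ᵇ m)) (S≗S′ w) (trans (nbrsIn≡count G _ w)
    (trans (count-cong λ w′ → cong (adj G w w′ ∧_) (S≗S′ w′)) (sym (nbrsIn≡count G _ w))))

  iter-cong : ∀ t {S S′} → S ≗ S′ → iter G k t S ≗ iter G k t S′
  iter-cong zero    S≗S′ = S≗S′
  iter-cong (suc t) S≗S′ = step-cong (iter-cong t S≗S′)

  iter-+ : ∀ d t S → iter G k (d + t) S ≗ iter G k d (iter G k t S)
  iter-+ zero    t S = λ _ → refl
  iter-+ (suc d) t S = step-cong (iter-+ d t S)

  step-extensive : ∀ S → S ⊆ step G k S
  step-extensive S w Sw≡true rewrite Sw≡true = refl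

  iter-extensive : ∀ t S → S ⊆ iter G k t S
  iter-extensive zero    S w = id
  iter-extensive (suc t) S w = step-extensive _ w ∘ iter-extensive t S w

  step-true : ∀ S w → (S w ≡ false → k ≤ nbrsIn G S w) → step G k S w ≡ true
  step-true S w enough with S w
  ... | true  = refl
  ... | false = dec-true (k ≤? nbrsIn G S w) (enough refl)

  step-false : ∀ S w → S w ≡ false → nbrsIn G S w < k → step G k S w ≡ false
  step-false S w Sw≡false few rewrite Sw≡false = dec-false (k ≤? nbrsIn G S w) (<⇒≱ few)

  Stable : VSet G → Set
  Stable S = step G k S ≗ S

  stable-if : ∀ S → (∀ w → S w ≡ false → nbrsIn G S w < k) → Stable S
  stable-if S few w with S w in Sw
  ... | true  = refl
  ... | false = dec-false (k ≤? nbrsIn G S w) (<⇒≱ (few w Sw))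

  stable⇒iter≗ : ∀ {S} → Stable S → ∀ t → iter G k t S ≗ S
  stable⇒iter≗ stable zero    w = refl
  stable⇒iter≗ stable (suc t) w = trans (step-cong (stable⇒iter≗ stable t) w) (stable w)

  stays-uncolored : ∀ w → (∀ T → T w ≡ false → nbrsIn G T w < k) →
                    ∀ S → S w ≡ false → ∀ t → iter G k t S w ≡ false
  stays-uncolored w few S Sw≡false zero    = Sw≡false
  stays-uncolored w few S Sw≡false (suc t) = step-false _ w uncolored (few _ uncolored)
    where
    uncolored = stays-uncolored w few S Sw≡false t

  stable-or-large : ∀ S t → Stable (iter G k t S) ⊎ t ≤ count (iter G k t S)
  stable-or-large S zero = inj₂ z≤n
  stable-or-large S (suc t) with stable-or-large S t
  ... | inj₁ stable = inj₁ (step-cong stable)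
  ... | inj₂ t≤count with count-⊆ (iter G k t S) (iter G k (suc t) S) (step-extensive _)
  ...   | inj₁ unchanged = inj₁ (step-cong (sym ∘ unchanged))
  ...   | inj₂ grown     = inj₂ (≤-trans (s≤s t≤count) grown)

  Converts : ℕ → VSet G → Set
  Converts t S = ∀ w → iter G k t S w ≡ true

  converts-within-N : ∀ S → IsConversionSet G k S → Converts (N G) S
  converts-within-N S (t , converts) with stable-or-large S (N G)
  ... | inj₂ N≤count = n≤count⇒true _ N≤count
  ... | inj₁ stable  = λ w → begin
    iter G k (N G) S w                ≡⟨ stable⇒iter≗ stable t w ⟨
    iter G k t (iter G k (N G) S) w   ≡⟨ iter-+ t (N G) S w ⟨
    iter G k (t + N G) S w            ≡⟨ cong (λ s → iter G k s S w) (+-comm t (N G)) ⟩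
    iter G k (N G + t) S w            ≡⟨ iter-+ (N G) t S w ⟩
    iter G k (N G) (iter G k t S) w   ≡⟨ iter-extensive (N G) _ w (converts w) ⟩
    true                              ∎
    where open ≡-Reasoning

  ConvSetOfSize : ℕ → Set
  ConvSetOfSize m = Σ (VSet G) λ S → Converts (N G) S × size G S ≡ m

  convSetOfSize? : ∀ m → Dec (ConvSetOfSize m)
  convSetOfSize? m = map′ fromSubset toSubset (anySubset? λ s → converts? (lookup s) ×-dec (size G (lookup s) ℕₚ.≟ m))
    where
    converts? : ∀ S → Dec (Converts (N G) S)
    converts? S = all? λ w → iter G k (N G) S w Boolₚ.≟ true
    fromSubset : (∃ λ s → Converts (N G) (lookup s) × size G (lookup s) ≡ m) → ConvSetOfSize m
    fromSubset (s , converts , sizeS) = lookup s , converts , sizeS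
    toSubset : ConvSetOfSize m → ∃ λ s → Converts (N G) (lookup s) × size G (lookup s) ≡ m
    toSubset (S , converts , sizeS) = tabulateᵥ S ,
      (λ w → trans (iter-cong (N G) (lookup∘tabulate S) w) (converts w)) ,
      trans (size-cong G (lookup∘tabulate S)) sizeS

  convNumber-exists : Σ ℕ (IsConvNumber G k)
  convNumber-exists = toConvNumber (least convSetOfSize? whole)
    where
    whole : ConvSetOfSize (size G (λ _ → true))
    whole = (λ _ → true) , (λ w → iter-extensive (N G) _ w refl) , refl
    toConvNumber : (Σ ℕ λ c → ConvSetOfSize c × ∀ m → ConvSetOfSize m → c ≤ m) → Σ ℕ (IsConvNumber G k)
    toConvNumber (c , (S , converts , sizeS) , minimal) =
      c , (S , (N G , converts) , sizeS) , λ S′ conv′ → minimal _ (S′ , converts-within-N S′ conv′ , refl)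

⌊≟⌋-refl : ∀ {m} (i : Fin m) → ⌊ i ≟ i ⌋ ≡ true
⌊≟⌋-refl i = trans (isYes≗does (i ≟ i)) (dec-true (i ≟ i) refl)

⌊≟⌋-≢ : ∀ {m} (i j : Fin m) → i ≢ j → ⌊ i ≟ j ⌋ ≡ false
⌊≟⌋-≢ i j i≢j = trans (isYes≗does (i ≟ j)) (dec-false (i ≟ j) i≢j)

cycAdj-inject₁ : ∀ {n} (j : Fin n) → cycAdj (suc n) (suc j) (Fin.inject₁ j) ≡ true
cycAdj-inject₁ {n} j = trans (cong (cycNext (suc n) (suc j) (Fin.inject₁ j) ∨_) predecessor) (Boolₚ.∨-zeroʳ _)
  where
  predecessor : cycNext (suc n) (Fin.inject₁ j) (suc j) ≡ true
  predecessor = cong (_∨ ((Fin.toℕ (Fin.inject₁ j) ≡ᵇ n) ∧ (Fin.toℕ (suc j) ≡ᵇ 0)))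
                     (dec-true (Fin.toℕ (Fin.inject₁ j) ℕₚ.≟ Fin.toℕ j) (Finₚ.toℕ-inject₁ j))

module Corona (n p : ℕ) where

  G : Graph
  G = corona n p

  v : Fin n → Fin (n * suc p)
  v i = combine i zero

  u : Fin n → Fin p → Fin (n * suc p)
  u i x = combine i (suc x)

  vertex-elim : (P : Fin (n * suc p) → Set) → (∀ i → P (v i)) → (∀ i x → P (u i x)) → ∀ w → P w
  vertex-elim P Pv Pu w = subst P (Finₚ.combine-remQuot {n} (suc p) w) (byPart (remQuot {n} (suc p) w))
    where
    byPart : ∀ ia → P (uncurry combine ia)
    byPart (i , zero)  = Pv i
    byPart (i , suc x) = Pu i x

  cycleNbrs : VSet G → Fin n → ℕ
  cycleNbrs T i = count (λ j → cycAdj n i j ∧ T (v j))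

  cliqueCount : VSet G → Fin n → ℕ
  cliqueCount T i = count (T ∘ u i)

  block : VSet G → Fin n → ℕ
  block T i = indicator (T (v i)) + cliqueCount T i

  size-corona : ∀ T → size G T ≡ ∑[ i < n ] block T i
  size-corona T = trans (size≡count G T) (sum-combine n (suc p) (indicator ∘ T))

  nbrsIn-combine : ∀ T i a → nbrsIn G T (combine i a) ≡
                   ∑[ j < n ] count (λ b → coronaAdj n p (i , a) (j , b) ∧ T (combine j b))
  nbrsIn-combine T i a = trans (nbrsIn≡count G T (combine i a)) (trans (sum-combine n (suc p) _)
    (sum-cong-≗ λ j → count-cong λ b → cong (_∧ T (combine j b)) (adj-combine j b)))
    where
    adj-combine : ∀ j b → adj G (combine i a) (combine j b) ≡ coronaAdj n p (i , a) (j , b)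
    adj-combine j b rewrite Finₚ.remQuot-combine {n} {suc p} i a | Finₚ.remQuot-combine {n} {suc p} j b = refl

  nbrsIn-v : ∀ T i → nbrsIn G T (v i) ≡ cliqueCount T i + cycleNbrs T i
  nbrsIn-v T i = begin
    nbrsIn G T (v i)
      ≡⟨ nbrsIn-combine T i zero ⟩
    ∑[ j < n ] (indicator (cycAdj n i j ∧ T (v j)) + count (λ y → ⌊ i ≟ j ⌋ ∧ T (u j y)))
      ≡⟨ ∑-distrib-+ (λ j → indicator (cycAdj n i j ∧ T (v j))) _ ⟩
    cycleNbrs T i + ∑[ j < n ] count (λ y → ⌊ i ≟ j ⌋ ∧ T (u j y))
      ≡⟨ cong (cycleNbrs T i +_) (sum-single i otherClique) ⟩
    cycleNbrs T i + count (λ y → ⌊ i ≟ i ⌋ ∧ T (u i y))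
      ≡⟨ cong (λ b → cycleNbrs T i + count (λ y → b ∧ T (u i y))) (⌊≟⌋-refl i) ⟩
    cycleNbrs T i + cliqueCount T i
      ≡⟨ +-comm (cycleNbrs T i) _ ⟩
    cliqueCount T i + cycleNbrs T i
      ∎
    where
    open ≡-Reasoning
    otherClique : ∀ j → j ≢ i → count (λ y → ⌊ i ≟ j ⌋ ∧ T (u j y)) ≡ 0
    otherClique j j≢i = count-false λ y → cong (_∧ T (u j y)) (⌊≟⌋-≢ i j (j≢i ∘ sym))

  nbrsIn-u : ∀ T i x → T (u i x) ≡ false → nbrsIn G T (u i x) ≡ indicator (T (v i)) + cliqueCount T i
  nbrsIn-u T i x uncolored = begin
    nbrsIn G T (u i x)
      ≡⟨ nbrsIn-combine T i (suc x) ⟩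
    ∑[ j < n ] count (λ b → coronaAdj n p (i , suc x) (j , b) ∧ T (combine j b))
      ≡⟨ sum-single i otherClique ⟩
    count (λ b → coronaAdj n p (i , suc x) (i , b) ∧ T (combine i b))
      ≡⟨ ownClique ⟩
    indicator (T (v i)) + count (λ y → not ⌊ x ≟ y ⌋ ∧ T (u i y))
      ≡⟨ cong (indicator (T (v i)) +_) (count-≢ (T ∘ u i) x uncolored) ⟩
    indicator (T (v i)) + cliqueCount T i
      ∎
    where
    open ≡-Reasoning
    otherClique : ∀ j → j ≢ i → count (λ b → coronaAdj n p (i , suc x) (j , b) ∧ T (combine j b)) ≡ 0
    otherClique j j≢i = count-false {f = λ b → coronaAdj n p (i , suc x) (j , b) ∧ T (combine j b)} λ
      { zero    → cong (_∧ T (v j)) (⌊≟⌋-≢ i j (j≢i ∘ sym))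
      ; (suc y) → cong (λ b → (b ∧ not ⌊ x ≟ y ⌋) ∧ T (u j y)) (⌊≟⌋-≢ i j (j≢i ∘ sym)) }
    ownClique : count (λ b → coronaAdj n p (i , suc x) (i , b) ∧ T (combine i b)) ≡
                indicator (T (v i)) + count (λ y → not ⌊ x ≟ y ⌋ ∧ T (u i y))
    ownClique rewrite ⌊≟⌋-refl i = refl

  nbrsIn-u≤p : ∀ T i x → T (u i x) ≡ false → nbrsIn G T (u i x) ≤ p
  nbrsIn-u≤p T i x uncolored = begin
    nbrsIn G T (u i x)                      ≡⟨ nbrsIn-u T i x uncolored ⟩
    indicator (T (v i)) + cliqueCount T i   ≤⟨ +-monoˡ-≤ _ (indicator≤1 (T (v i))) ⟩
    suc (cliqueCount T i)                   ≤⟨ count<n (T ∘ u i) x uncolored ⟩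
    p                                       ∎
    where open ≤-Reasoning

  CliquesFull : VSet G → Set
  CliquesFull T = ∀ i x → T (u i x) ≡ true

  size-cliquesFull : ∀ T → CliquesFull T → size G T ≡ p * n + ∑[ i < n ] indicator (T (v i))
  size-cliquesFull T full = begin
    size G T                                        ≡⟨ size-corona T ⟩
    ∑[ i < n ] (indicator (T (v i)) + cliqueCount T i)
      ≡⟨ sum-cong-≗ (λ i → cong (indicator (T (v i)) +_) (count-true (full i))) ⟩
    ∑[ i < n ] (indicator (T (v i)) + p)            ≡⟨ ∑-distrib-+ (indicator ∘ T ∘ v) (λ _ → p) ⟩
    ∑[ i < n ] indicator (T (v i)) + ∑[ i < n ] p
      ≡⟨ cong (∑[ i < n ] indicator (T (v i)) +_) (trans (sum-const n p) (*-comm n p)) ⟩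
    ∑[ i < n ] indicator (T (v i)) + p * n          ≡⟨ +-comm _ (p * n) ⟩
    p * n + ∑[ i < n ] indicator (T (v i))          ∎
    where open ≡-Reasoning

module HighThreshold (n p k : ℕ) (p<k : p < k) where

  open Corona n p
  module C = Corona n 0

  spine : VSet G → VSet C.G
  spine T z = T (v (proj₁ (remQuot {n} 1 z)))

  spine-v : ∀ T i → spine T (C.v i) ≡ T (v i)
  spine-v T i = cong (λ iz → T (v (proj₁ iz))) (Finₚ.remQuot-combine {n} {1} i zero)

  withCliques : VSet C.G → VSet G
  withCliques S w = fill (remQuot {n} (suc p) w)
    where
    fill : Fin n × Fin (suc p) → Bool
    fill (i , zero)  = S (C.v i)
    fill (_ , suc _) = true

  withCliques-v : ∀ S i → withCliques S (v i) ≡ S (C.v i)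
  withCliques-v S i rewrite Finₚ.remQuot-combine {n} {suc p} i zero = refl

  withCliques-u : ∀ S → CliquesFull (withCliques S)
  withCliques-u S i x rewrite Finₚ.remQuot-combine {n} {suc p} i (suc x) = refl

  spine-withCliques : ∀ S → spine (withCliques S) ≗ S
  spine-withCliques S = C.vertex-elim _ (λ i → trans (spine-v (withCliques S) i) (withCliques-v S i)) λ _ ()

  size-spine : ∀ T → CliquesFull T → size G T ≡ p * n + size C.G (spine T)
  size-spine T full = trans (size-cliquesFull T full) (cong (p * n +_) (sym (begin
    size C.G (spine T)                         ≡⟨ C.size-cliquesFull (spine T) (λ _ ()) ⟩
    ∑[ i < n ] indicator (spine T (C.v i))     ≡⟨ sum-cong-≗ (cong indicator ∘ spine-v T) ⟩
    ∑[ i < n ] indicator (T (v i))             ∎)))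
    where open ≡-Reasoning

  spine-step : ∀ T → CliquesFull T → spine (step G k T) ≗ step C.G (k ∸ p) (spine T)
  spine-step T full = C.vertex-elim _
    (λ i → trans (spine-v (step G k T) i) (cong₂ _∨_ (sym (spine-v T i)) (threshold i))) λ _ ()
    where
    open ≡-Reasoning
    threshold : ∀ i → (k ≤ᵇ nbrsIn G T (v i)) ≡ (k ∸ p ≤ᵇ nbrsIn C.G (spine T) (C.v i))
    threshold i = begin
      (k ≤ᵇ nbrsIn G T (v i))                  ≡⟨ cong (k ≤ᵇ_) (nbrsIn-v T i) ⟩
      (k ≤ᵇ cliqueCount T i + cycleNbrs T i)   ≡⟨ cong (λ c → k ≤ᵇ c + cycleNbrs T i) (count-true (full i)) ⟩
      (k ≤ᵇ p + cycleNbrs T i)                 ≡⟨ does-⇔ shift (k ≤? _) (k ∸ p ≤? _) ⟩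
      (k ∸ p ≤ᵇ cycleNbrs T i)
        ≡⟨ cong (k ∸ p ≤ᵇ_) (sym (sum-cong-≗ λ j → cong (λ b → indicator (cycAdj n i j ∧ b)) (spine-v T j))) ⟩
      (k ∸ p ≤ᵇ C.cycleNbrs (spine T) i)       ≡⟨ cong (k ∸ p ≤ᵇ_) (C.nbrsIn-v (spine T) i) ⟨
      (k ∸ p ≤ᵇ nbrsIn C.G (spine T) (C.v i))  ∎
      where
      shift : k ≤ p + cycleNbrs T i ⇔ k ∸ p ≤ cycleNbrs T i
      shift = mk⇔ (m≤n+o⇒m∸n≤o k p) λ k∸p≤ → ≤-trans (m≤n+m∸n k p) (+-monoʳ-≤ p k∸p≤)

  spine-iter : ∀ T → CliquesFull T → ∀ t → spine (iter G k t T) ≗ iter C.G (k ∸ p) t (spine T)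
  spine-iter T full zero    = λ _ → refl
  spine-iter T full (suc t) = λ z → trans
    (spine-step (iter G k t T) (λ i x → iter-extensive G k t T (u i x) (full i x)) z)
    (step-cong C.G (k ∸ p) (spine-iter T full t) z)

  conversionSet⇒cliquesFull : ∀ S → IsConversionSet G k S → CliquesFull S
  conversionSet⇒cliquesFull S (t , converts) i x with S (u i x) in uncolored
  ... | true  = refl
  ... | false = case trans (sym (converts (u i x))) (stays-uncolored G k (u i x) few S uncolored t) of λ ()
    where
    few : ∀ T → T (u i x) ≡ false → nbrsIn G T (u i x) < k
    few T uncoloredᵀ = ≤-<-trans (nbrsIn-u≤p T i x uncoloredᵀ) p<k

  convNumber : ∀ c → IsConvNumber C.G (k ∸ p) c → IsConvNumber G k (p * n + c)
  convNumber c ((S , (t , converts) , sizeS) , minimal) =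
    (withCliques S , (t , convertsᴳ) , sizeᴳ) ,
    λ S′ conv′ → lower S′ conv′ (conversionSet⇒cliquesFull S′ conv′)
    where
    convertsᴳ : ∀ w → iter G k t (withCliques S) w ≡ true
    convertsᴳ = vertex-elim _
      (λ i → begin
        iter G k t (withCliques S) (v i)                  ≡⟨ spine-v (iter G k t (withCliques S)) i ⟨
        spine (iter G k t (withCliques S)) (C.v i)        ≡⟨ spine-iter _ (withCliques-u S) t (C.v i) ⟩
        iter C.G (k ∸ p) t (spine (withCliques S)) (C.v i) ≡⟨ iter-cong C.G (k ∸ p) t (spine-withCliques S) (C.v i) ⟩
        iter C.G (k ∸ p) t S (C.v i)                      ≡⟨ converts (C.v i) ⟩
        true                                              ∎)
      (λ i x → iter-extensive G k t _ (u i x) (withCliques-u S i x))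
      where open ≡-Reasoning
    sizeᴳ : size G (withCliques S) ≡ p * n + c
    sizeᴳ = trans (size-spine _ (withCliques-u S)) (cong (p * n +_) (trans (size-cong C.G (spine-withCliques S)) sizeS))
    lower : ∀ S′ → IsConversionSet G k S′ → CliquesFull S′ → p * n + c ≤ size G S′
    lower S′ (t′ , converts′) full = subst (p * n + c ≤_) (sym (size-spine S′ full))
      (+-monoʳ-≤ (p * n) (minimal (spine S′) (t′ , λ z → trans (sym (spine-iter S′ full t′ z)) (converts′ _))))

module LowThreshold (n′ q k₀ : ℕ) (k₀≤q : k₀ ≤ q) where

  open Corona (suc n′) q

  -- The clique clause comes first so that seedAt (i , suc x) computes for a variable i.
  seedAt : Fin (suc n′) × Fin (suc q) → Bool
  seedAt (_     , suc x) = below k₀ x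
  seedAt (zero  , zero)  = true
  seedAt (suc _ , zero)  = false

  seed : VSet G
  seed w = seedAt (remQuot {suc n′} (suc q) w)

  seed-combine : ∀ i a → seed (combine i a) ≡ seedAt (i , a)
  seed-combine i a = cong seedAt (Finₚ.remQuot-combine i a)

  cliqueCount-seed : ∀ i → cliqueCount seed i ≡ k₀
  cliqueCount-seed i = trans (count-cong (λ x → seed-combine i (suc x))) (count-below k₀ k₀≤q)

  size-seed : size G seed ≡ k₀ * suc n′ + 1
  size-seed = begin
    size G seed                                                     ≡⟨ size-corona seed ⟩
    ∑[ i < suc n′ ] block seed i
      ≡⟨ ∑-distrib-+ (indicator ∘ seed ∘ v) (cliqueCount seed) ⟩
    ∑[ i < suc n′ ] indicator (seed (v i)) + ∑[ i < suc n′ ] cliqueCount seed i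
      ≡⟨ cong₂ _+_ (trans (sum-single zero onlyFirst) (cong indicator (seed-combine zero zero)))
                   (trans (sum-cong-≗ cliqueCount-seed) (sum-const (suc n′) k₀)) ⟩
    1 + suc n′ * k₀                                                 ≡⟨ +-comm 1 _ ⟩
    suc n′ * k₀ + 1                                                 ≡⟨ cong (_+ 1) (*-comm (suc n′) k₀) ⟩
    k₀ * suc n′ + 1                                                 ∎
    where
    open ≡-Reasoning
    onlyFirst : ∀ i → i ≢ zero → indicator (seed (v i)) ≡ 0
    onlyFirst zero    i≢0 = ⊥-elim (i≢0 refl)
    onlyFirst (suc i) _   = cong indicator (seed-combine (suc i) zero)

  k₀≤cliqueCount-iter-seed : ∀ t i → k₀ ≤ cliqueCount (iter G (suc k₀) t seed) i
  k₀≤cliqueCount-iter-seed t i = subst (_≤ cliqueCount (iter G (suc k₀) t seed) i) (cliqueCount-seed i)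
    (count-mono λ x → iter-extensive G (suc k₀) t seed (u i x))

  spine-colored : ∀ t i → Fin.toℕ i ≤ t → iter G (suc k₀) t seed (v i) ≡ true
  spine-colored zero    zero    _         = seed-combine zero zero
  spine-colored (suc t) zero    _         = iter-extensive G (suc k₀) (suc t) seed (v zero) (seed-combine zero zero)
  spine-colored (suc t) (suc j) (s≤s j≤t) = step-true G (suc k₀) X (v (suc j)) λ _ → begin
    1 + k₀                                         ≡⟨ +-comm 1 k₀ ⟩
    k₀ + 1                                         ≤⟨ +-mono-≤ (k₀≤cliqueCount-iter-seed t (suc j)) predecessor ⟩
    cliqueCount X (suc j) + cycleNbrs X (suc j)    ≡⟨ nbrsIn-v X (suc j) ⟨
    nbrsIn G X (v (suc j))                         ∎
    where
    open ≤-Reasoning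
    X = iter G (suc k₀) t seed
    previous : X (v (Fin.inject₁ j)) ≡ true
    previous = spine-colored t (Fin.inject₁ j) (subst (_≤ t) (sym (Finₚ.toℕ-inject₁ j)) j≤t)
    predecessor : 1 ≤ cycleNbrs X (suc j)
    predecessor = ≤-trans
      (≤-reflexive (cong indicator (sym (cong₂ _∧_ (cycAdj-inject₁ j) previous))))
      (term≤sum {f = λ j′ → indicator (cycAdj (suc n′) (suc j) j′ ∧ X (v j′))} (Fin.inject₁ j))

  seed-converts : IsConversionSet G (suc k₀) seed
  seed-converts = suc n′ , vertex-elim _
    (λ i → spine-colored (suc n′) i (<⇒≤ (Finₚ.toℕ<n i)))
    (λ i x → step-true G (suc k₀) X (u i x) λ uncolored → begin
      1 + k₀                               ≤⟨ +-monoʳ-≤ 1 (k₀≤cliqueCount-iter-seed n′ i) ⟩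
      1 + cliqueCount X i
        ≡⟨ cong (λ b → indicator b + cliqueCount X i) (spine-colored n′ i (≤-pred (Finₚ.toℕ<n i))) ⟨
      indicator (X (v i)) + cliqueCount X i ≡⟨ nbrsIn-u X i x uncolored ⟨
      nbrsIn G X (u i x)                   ∎)
    where
    open ≤-Reasoning
    X = iter G (suc k₀) n′ seed

  clique-frozen : ∀ S j → cliqueCount S j < k₀ → ∀ t → iter G (suc k₀) t S ∘ u j ≗ S ∘ u j
  clique-frozen S j few zero    y = refl
  clique-frozen S j few (suc t) y with S (u j y) in Sy
  ... | true  = iter-extensive G (suc k₀) (suc t) S (u j y) Sy
  ... | false = step-false G (suc k₀) X (u j y) stillUncolored (begin-strict
    nbrsIn G X (u j y)                      ≡⟨ nbrsIn-u X j y stillUncolored ⟩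
    indicator (X (v j)) + cliqueCount X j   ≡⟨ cong (indicator (X (v j)) +_) (count-cong (clique-frozen S j few t)) ⟩
    indicator (X (v j)) + cliqueCount S j   <⟨ +-mono-≤-< (indicator≤1 (X (v j))) few ⟩
    1 + k₀                                  ∎)
    where
    open ≤-Reasoning
    X = iter G (suc k₀) t S
    stillUncolored : X (u j y) ≡ false
    stillUncolored = trans (clique-frozen S j few t y) Sy

  k₀≤cliqueCount : ∀ S → IsConversionSet G (suc k₀) S → ∀ j → k₀ ≤ cliqueCount S j
  k₀≤cliqueCount S (t , converts) j with k₀ ≤? cliqueCount S j
  ... | yes k₀≤ = k₀≤
  ... | no  k₀≰ with count<n⇒∃false (S ∘ u j) (<-≤-trans (≰⇒> k₀≰) k₀≤q)
  ...   | y , Sy = case trans (sym (converts (u j y))) (trans (clique-frozen S j (≰⇒> k₀≰) t y) Sy) of λ ()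

  module _ (S : VSet G) (k₀≤ : ∀ i → k₀ ≤ cliqueCount S i) (small : ∀ i → block S i ≤ k₀) where

    tight-spine-uncolored : ∀ i → S (v i) ≡ false
    tight-spine-uncolored i with S (v i) in Svi
    ... | false = refl
    ... | true  = ⊥-elim (<⇒≱ (s≤s (k₀≤ i)) (subst (λ b → indicator b + cliqueCount S i ≤ k₀) Svi (small i)))

    tight-stable : Stable G (suc k₀) S
    tight-stable = stable-if G (suc k₀) S (vertex-elim _
      (λ i _ → s≤s (begin
        nbrsIn G S (v i)                   ≡⟨ nbrsIn-v S i ⟩
        cliqueCount S i + cycleNbrs S i    ≡⟨ cong (cliqueCount S i +_) (noCycleNbrs i) ⟩
        cliqueCount S i + 0                ≡⟨ +-identityʳ _ ⟩
        cliqueCount S i                    ≤⟨ m≤n+m _ _ ⟩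
        block S i                          ≤⟨ small i ⟩
        k₀                                 ∎))
      (λ i x uncolored → s≤s (begin
        nbrsIn G S (u i x)                 ≡⟨ nbrsIn-u S i x uncolored ⟩
        block S i                          ≤⟨ small i ⟩
        k₀                                 ∎)))
      where
      open ≤-Reasoning
      noCycleNbrs : ∀ i → cycleNbrs S i ≡ 0
      noCycleNbrs i = count-false {f = λ j → cycAdj (suc n′) i j ∧ S (v j)}
        λ j → trans (cong (cycAdj (suc n′) i j ∧_) (tight-spine-uncolored j)) (Boolₚ.∧-zeroʳ _)

  seed-minimal : ∀ S → IsConversionSet G (suc k₀) S → k₀ * suc n′ + 1 ≤ size G S
  seed-minimal S conv@(t , converts) with Finₚ.any? (λ i → suc k₀ ≤? block S i)
  ... | yes (i , big) = begin
    k₀ * suc n′ + 1       ≡⟨ cong (_+ 1) (*-comm k₀ (suc n′)) ⟩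
    suc n′ * k₀ + 1       ≡⟨ +-comm _ 1 ⟩
    suc (suc n′ * k₀)
      ≤⟨ *-<-sum {f = block S} k₀ (λ j → ≤-trans (k₀≤cliqueCount S conv j) (m≤n+m _ _)) i big ⟩
    ∑[ i < suc n′ ] block S i ≡⟨ size-corona S ⟨
    size G S              ∎
    where open ≤-Reasoning
  ... | no noneBig = case trans (sym (converts (v zero))) (trans frozen (tight-spine-uncolored S k₀≤ small zero)) of λ ()
    where
    k₀≤ = k₀≤cliqueCount S conv
    small : ∀ i → block S i ≤ k₀
    small i = ≤-pred (≰⇒> λ big → noneBig (i , big))
    frozen : iter G (suc k₀) t S (v zero) ≡ S (v zero)
    frozen = stable⇒iter≗ G (suc k₀) (tight-stable S k₀≤ small) t (v zero)

  convNumber : IsConvNumber G (suc k₀) (k₀ * suc n′ + 1)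
  convNumber = (seed , seed-converts , size-seed) , seed-minimal

mainTheorem1 : (n p k : ℕ) → n ≥ 3 → p ≥ 1 → k ≥ 1
    → Σ ℕ (λ c → IsConvNumber (corona n (p ∸ ((k ∸ 1) ⊓ p))) (k ∸ ((k ∸ 1) ⊓ p)) c
        × IsConvNumber (corona n p) k (((k ∸ 1) ⊓ p) * n + c))
mainTheorem1 (suc n′) p (suc k₀) _ _ _ with p ≤? k₀
... | yes p≤k₀ rewrite m≥n⇒m⊓n≡n p≤k₀ | n∸n≡0 p =
  let c , isConvNumber = convNumber-exists (corona (suc n′) 0) (suc k₀ ∸ p)
  in  c , isConvNumber , HighThreshold.convNumber (suc n′) p (suc k₀) (s≤s p≤k₀) c isConvNumber
... | no p≰k₀ rewrite m≤n⇒m⊓n≡m (<⇒≤ (≰⇒> p≰k₀)) | m+n∸n≡m 1 k₀ =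
  1 , LowThreshold.convNumber n′ (p ∸ k₀) 0 z≤n , LowThreshold.convNumber n′ p k₀ (<⇒≤ (≰⇒> p≰k₀))
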